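{- For every $X\subseteq 2^\omega$ the following are equivalent: (1) $\mathcal{F}_X$ is rapid; (2) for every partitioning real $d$, $X$ goes through some $d$-binary slalom; (3) for every partitioning real $d$, the set $\mathrm{nat}_d[X]=\{\mathrm{nat}_d(x):x\in X\}\subseteq\omega^\omega$ goes through some slalom.
   Context: Subsets of $\omega$ are identified with elements of $2^\omega$; a natural number $n$ is identified with $\{0,\dots,n-1\}$. For distinct $x,y\in 2^\omega$ let $h(x,y)=\min\{n:x(n)\neq y(n)\}$; for $X\subseteq 2^\omega$ let $H(X)=\{h(x,y):x,y\in X, x\neq y\}$. The Raisonnier filter $\mathcal{F}_X$ is the set of all $a\subseteq\omega$ for which there is a countable family $\{Y_n:n<\omega\}$ of subsets of $2^\omega$ with $X\subseteq\bigcup_nY_n$ and $a\supseteq\bigcup_nH(Y_n)$. A filter $\mathcal{F}$ on $\omega$ (the trivial filter $\mathcal{P}(\omega)$ included) is rapid if for every increasing $f\in\omega^\omega$ there is $a\in\mathcal{F}$ with $|a\cap f(n)|\le n$ for all $n$. A partitioning real is a strictly increasing $d\in\omega^\omega$ with $d(0)=0$; write $I^d_n=[d(n),d(n+1))$. A $d$-binary slalom is a function $B$ on $\omega$ such that for each $n$, $B(n)\subseteq\{0,1\}^{|I^d_n|}$ and $|B(n)|\le n$; $x\in 2^\omega$ goes through $B$ if $x\restriction I^d_n\in B(n)$ for all but finitely many $n$, and $X$ goes through $B$ if every $x\in X$ does. A slalom is a function $S:\omega\to[\omega]^{<\omega}$ with $|S(n)|\le n$ for all $n$; $f\in\omega^\omega$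 goes through $S$ if $f(n)\in S(n)$ for all but finitely many $n$, and a set goes through $S$ if each of its elements does. $\mathrm{nat}:2^{<\omega}\to\omega$ maps a finite binary sequence to the natural number it represents in binary, and $\mathrm{nat}_d(x)(n)=\mathrm{nat}(x\restriction I^d_n)$ for $x\in 2^\omega$. -}

module Defs where

open import Level using (Level; _⊔_) renaming (suc to lsuc; zero to lzero)
open import Data.Nat using (ℕ; zero; suc; _+_; _*_; _∸_; _≤_; _<_)
open import Data.Bool using (Bool; true; false)
open import Data.Fin using (toℕ)
open import Data.Vec using (Vec; tabulate; foldl)
open import Data.List using (List; length)
open import Data.List.Membership.Propositional using (_∈_)
open import Data.Product using (Σ; ∃; ∃-syntax; _×_)
open import Relation.Binary.PropositionalEquality using (_≡_; _≢_)

-- 2^ω : infinite binary sequences (also used for subsets of ω)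
Real : Set
Real = ℕ → Bool

SetOfReals : Set₁
SetOfReals = Real → Set

HIs : Real → Real → ℕ → Set
HIs x y n = (∀ m → m < n → x m ≡ y m) × (x n ≢ y n)

InH : SetOfReals → ℕ → Set
InH Y n = Σ Real λ x → Σ Real λ y → Y x × Y y × HIs x y n

RaisonnierFilter : SetOfReals → (ℕ → Bool) → Set₁
RaisonnierFilter X a =
  Σ (ℕ → SetOfReals) λ Y →
    (∀ x → X x → ∃[ n ] Y n x) ×
    (∀ n k → InH (Y n) k → a k ≡ true)

count : (ℕ → Bool) → ℕ → ℕ
count a zero = zero
count a (suc m) with a m
... | true  = suc (count a m)
... | false = count a m

StrictlyIncreasing : (ℕ → ℕ) → Set
StrictlyIncreasing f = ∀ n → f n < f (suc n)

Rapid : ∀ {ℓ} → ((ℕ → Bool) → Set ℓ) → Set ℓ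
Rapid F = ∀ (f : ℕ → ℕ) → StrictlyIncreasing f →
  Σ (ℕ → Bool) λ a → F a × (∀ n → count a (f n) ≤ n)

PartitioningReal : (ℕ → ℕ) → Set
PartitioningReal d = (d 0 ≡ 0) × StrictlyIncreasing d

len : (ℕ → ℕ) → ℕ → ℕ
len d n = d (suc n) ∸ d n

restrict : (d : ℕ → ℕ) → Real → (n : ℕ) → Vec Bool (len d n)
restrict d x n = tabulate λ i → x (d n + toℕ i)

record BinarySlalom (d : ℕ → ℕ) : Set where
  field
    B     : (n : ℕ) → List (Vec Bool (len d n))
    bound : ∀ n → length (B n) ≤ n

GoesThroughBin : (d : ℕ → ℕ) → BinarySlalom d → Real → Set
GoesThroughBin d S x = ∃[ N ] (∀ n → N ≤ n → restrict d x n ∈ BinarySlalom.B S n)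

SetGoesThroughBin : (d : ℕ → ℕ) → BinarySlalom d → SetOfReals → Set
SetGoesThroughBin d S X = ∀ x → X x → GoesThroughBin d S x

record Slalom : Set where
  field
    S     : ℕ → List ℕ
    bound : ∀ n → length (S n) ≤ n

GoesThrough : Slalom → (ℕ → ℕ) → Set
GoesThrough S f = ∃[ N ] (∀ n → N ≤ n → f n ∈ Slalom.S S n)

bit : Bool → ℕ
bit false = 0
bit true  = 1

-- nat : binary word → number, first bit most significant
nat : ∀ {k} → Vec Bool k → ℕ
nat = foldl (λ _ → ℕ) (λ acc b → 2 * acc + bit b) 0

nat-d : (ℕ → ℕ) → Real → (ℕ → ℕ)
nat-d d x n = nat (restrict d x n)

ImageGoesThrough : (d : ℕ → ℕ) → Slalom → SetOfReals → Set
ImageGoesThrough d S X = ∀ x → X x → GoesThrough S (nat-d d x)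

{-# OPTIONS --safe #-}
module Submission where

-- (2) ⇔ (3) because nat is injective on words of a fixed length.
-- (1) ⇒ (2): take a ∈ 𝓕_X, witnessed by a cover (Y j), meeting d (entry k) in at most k points.
-- Two members of Y j first differ at a point of H(Y j) ⊆ a, so on Y j the word x ↾ I_n is
-- determined by x on a ∩ d (n + 1); hence Y j contributes at most 2 ^ |a ∩ d (n + 1)| words to
-- block n, and from block entry j on there is room for them.
-- (2) ⇒ (1): given f, choose the partition d (n + 1) = f (0² + ⋯ + (n + 1)²) and a slalom B for
-- it, and split X into the cells of reals going through B from block N on with a fixed initial
-- segment below d N. Two members of a cell first differ inside some block n ≥ N, at a place
-- determined by their two words in B n, so the union a of the H(cell) meets block n in at most
-- n² points, which is exactly what rapidity for f asks.

open import Defs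
open import Level using (Level; 0ℓ)
open import Data.Nat using (ℕ; zero; suc; _+_; _*_; _∸_; _^_; _≤_; _<_; z≤n; s≤s; s≤s⁻¹; NonZero)
open import Data.Nat.Properties
open import Data.Nat.DivMod using (_/_; m/n*n≤m; m*n/n≡m; /-monoˡ-≤)
open import Data.Bool using (Bool; true; false)
open import Data.Bool.Properties using (T-≡) renaming (_≟_ to _≟ᴮ_)
open import Data.Fin using (toℕ; fromℕ<)
open import Data.Fin.Properties using (toℕ-fromℕ<; toℕ<n)
import Data.Vec as Vec
open Vec using (Vec; tabulate; lookup; replicate)
open import Data.Vec.Properties using (lookup∘tabulate; tabulate-cong)
open import Data.List using (List; []; _∷_; _++_; length; map; filter; downFrom; upTo; cartesianProductWith)
open import Data.List.Properties using (length-map; length-++; length-upTo; ∷-injective; filter-notAll)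
open import Data.List.Membership.Propositional using (_∈_)
open import Data.List.Membership.Propositional.Properties
  using (∈-map⁺; ∈-filter⁺; ∈-downFrom⁺; ∈-upTo⁺; ∈-cartesianProductWith⁺)
import Data.List.Relation.Unary.Any as Any
open Any using (here; there)
open import Data.Product using (Σ; _×_; _,_; proj₁; proj₂; ∃-syntax; curry)
open import Data.Sum using (_⊎_; inj₁; inj₂; [_,_])
open import Data.Unit using (⊤; tt)
open import Function.Bundles using (_⇔_; mk⇔; Equivalence)
open import Relation.Nullary using (Dec; yes; no; ¬?; contradiction)
open import Relation.Nullary.Decidable using (isYes; toWitness; fromWitness; T?)
open import Relation.Binary.PropositionalEquality hiding ([_])
open import Axiom.ExcludedMiddle using (ExcludedMiddle)

module Increasing {f : ℕ → ℕ} (f-inc : StrictlyIncreasing f) where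

  mono-< : ∀ {i j} → i < j → f i < f j
  mono-< {i} {suc j} i<1+j with m<1+n⇒m<n∨m≡n i<1+j
  ... | inj₁ i<j  = <-trans (mono-< i<j) (f-inc j)
  ... | inj₂ refl = f-inc i

  mono-≤ : ∀ {i j} → i ≤ j → f i ≤ f j
  mono-≤ i≤j with m≤n⇒m<n∨m≡n i≤j
  ... | inj₁ i<j  = <⇒≤ (mono-< i<j)
  ... | inj₂ refl = ≤-refl

  cancel-≤ : ∀ {i j} → f i ≤ f j → i ≤ j
  cancel-≤ fi≤fj = ≮⇒≥ (λ j<i → <⇒≱ (mono-< j<i) fi≤fj)

  cancel-< : ∀ {i j} → f i < f j → i < j
  cancel-< fi<fj = ≰⇒> (λ j≤i → <⇒≱ fi<fj (mono-≤ j≤i))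

  bracket : ∀ n → f 0 ≤ n → ∃[ k ] f k ≤ n × n < f (suc k)
  bracket zero f0≤0 = 0 , f0≤0 , ≤-<-trans z≤n (f-inc 0)
  bracket (suc n) f0≤1+n with m≤n⇒m<n∨m≡n f0≤1+n
  ... | inj₂ f0≡1+n = 0 , f0≤1+n , subst (_< f 1) f0≡1+n (f-inc 0)
  ... | inj₁ f0<1+n with bracket n (s≤s⁻¹ f0<1+n)
  ...   | k , fk≤n , n<fk+1 with m≤n⇒m<n∨m≡n n<fk+1
  ...     | inj₁ 1+n<fk+1 = k , m≤n⇒m≤1+n fk≤n , 1+n<fk+1
  ...     | inj₂ 1+n≡fk+1 =
    suc k , ≤-reflexive (sym 1+n≡fk+1) , subst (_< f (suc (suc k))) (sym 1+n≡fk+1) (f-inc (suc k))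

count-suc : ∀ a m → count a m ≤ count a (suc m)
count-suc a m with a m
... | true  = n≤1+n _
... | false = ≤-refl

count-mono : ∀ a {m m′} → m ≤ m′ → count a m ≤ count a m′
count-mono a {m′ = zero}   z≤n    = ≤-refl
count-mono a {m′ = suc m′} m≤1+m′ with m≤n⇒m<n∨m≡n m≤1+m′
... | inj₁ m<1+m′ = ≤-trans (count-mono a (s≤s⁻¹ m<1+m′)) (count-suc a m′)
... | inj₂ refl   = ≤-refl

count-≤-+length : ∀ a {l m} (L : List ℕ) → l ≤ m →
  (∀ {k} → l ≤ k → k < m → a k ≡ true → k ∈ L) → count a m ≤ count a l + length L
count-≤-+length a {m = zero} L z≤n _ = z≤n
count-≤-+length a {l} {suc m} L l≤1+m covered with m≤n⇒m<n∨m≡n l≤1+m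
... | inj₂ refl = m≤m+n _ _
... | inj₁ l<1+m with a m in am
...   | false = count-≤-+length a L (s≤s⁻¹ l<1+m) (λ l≤k k<m → covered l≤k (m<n⇒m<1+n k<m))
...   | true  = begin
  suc (count a m)              ≤⟨ s≤s (count-≤-+length a L′ l≤m covered′) ⟩
  suc (count a l + length L′)  ≡⟨ +-suc _ _ ⟨
  count a l + suc (length L′)  ≤⟨ +-monoʳ-≤ (count a l) (filter-notAll ≢m? L m∈L) ⟩
  count a l + length L         ∎
  where
  open ≤-Reasoning
  l≤m = s≤s⁻¹ l<1+m
  ≢m? = λ k → ¬? (k ≟ m)
  L′ = filter ≢m? L
  covered′ : ∀ {k} → l ≤ k → k < m → a k ≡ true → k ∈ L′
  covered′ l≤k k<m ak = ∈-filter⁺ ≢m? (covered l≤k (m<n⇒m<1+n k<m) ak) (<⇒≢ k<m)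
  m∈L = Any.map (λ m≡k k≢m → k≢m (sym m≡k)) (covered l≤m (n<1+n m) am)

positions : (ℕ → Bool) → ℕ → List ℕ
positions a m = filter (λ i → T? (a i)) (downFrom m)

length-positions : ∀ a m → length (positions a m) ≡ count a m
length-positions a zero = refl
length-positions a (suc m) with a m
... | true  = cong suc (length-positions a m)
... | false = length-positions a m

∈-positions : ∀ a {m i} → i < m → a i ≡ true → i ∈ positions a m
∈-positions a i<m ai = ∈-filter⁺ (λ i → T? (a i)) (∈-downFrom⁺ i<m) (Equivalence.from T-≡ ai)

map-≡⇒≡-on : ∀ {A B : Set} {f g : A → B} {xs} → map f xs ≡ map g xs → ∀ {x} → x ∈ xs → f x ≡ g x
map-≡⇒≡-on {xs = _ ∷ _} eq (here refl)  = proj₁ (∷-injective eq)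
map-≡⇒≡-on {xs = _ ∷ _} eq (there x∈xs) = map-≡⇒≡-on (proj₂ (∷-injective eq)) x∈xs

length-cartesianProductWith : ∀ {A B C : Set} (f : A → B → C) xs ys →
  length (cartesianProductWith f xs ys) ≡ length xs * length ys
length-cartesianProductWith f []       ys = refl
length-cartesianProductWith f (x ∷ xs) ys = begin
  length (map (f x) ys ++ cartesianProductWith f xs ys)          ≡⟨ length-++ (map (f x) ys) ⟩
  length (map (f x) ys) + length (cartesianProductWith f xs ys)  ≡⟨ cong₂ _+_ (length-map (f x) ys)
                                                                          (length-cartesianProductWith f xs ys) ⟩
  length ys + length xs * length ys                              ∎
  where open ≡-Reasoning

bitStrings : ℕ → List (List Bool)
bitStrings zero    = [] ∷ []
bitStrings (suc n) = cartesianProductWith _∷_ (true ∷ false ∷ []) (bitStrings n)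

length-bitStrings : ∀ n → length (bitStrings n) ≡ 2 ^ n
length-bitStrings zero    = refl
length-bitStrings (suc n) =
  trans (length-cartesianProductWith _∷_ (true ∷ false ∷ []) (bitStrings n)) (cong (2 *_) (length-bitStrings n))

∈-bitStrings : ∀ bs → bs ∈ bitStrings (length bs)
∈-bitStrings []       = here refl
∈-bitStrings (b ∷ bs) = ∈-cartesianProductWith⁺ _∷_ (∈-bools b) (∈-bitStrings bs)
  where
  ∈-bools : ∀ b → b ∈ true ∷ false ∷ []
  ∈-bools true  = here refl
  ∈-bools false = there (here refl)

horner-injective : ∀ m m′ b b′ → 2 * m + bit b ≡ 2 * m′ + bit b′ → m ≡ m′ × b ≡ b′
horner-injective m m′ false false eq =
  *-cancelˡ-≡ m m′ 2 (trans (sym (+-identityʳ _)) (trans eq (+-identityʳ _))) , refl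
horner-injective m m′ true  true  eq = *-cancelˡ-≡ m m′ 2 (+-cancelʳ-≡ _ _ _ eq) , refl
horner-injective m m′ false true  eq =
  contradiction (trans (sym (+-identityʳ _)) (trans eq (+-comm _ 1))) (even≢odd m m′)
horner-injective m m′ true  false eq =
  contradiction (trans (sym (+-identityʳ _)) (trans (sym eq) (+-comm _ 1))) (even≢odd m′ m)

natFrom : ∀ {k} → ℕ → Vec Bool k → ℕ
natFrom = Vec.foldl (λ _ → ℕ) (λ acc b → 2 * acc + bit b)

natFrom-injective : ∀ {k} acc acc′ (v w : Vec Bool k) → natFrom acc v ≡ natFrom acc′ w → acc ≡ acc′ × v ≡ w
natFrom-injective acc acc′ Vec.[] Vec.[] eq = eq , refl
natFrom-injective acc acc′ (b Vec.∷ v) (b′ Vec.∷ w) eq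
  with acc₂≡ , v≡w ← natFrom-injective _ _ v w eq
  with acc≡ , b≡b′ ← horner-injective acc acc′ b b′ acc₂≡ = acc≡ , cong₂ Vec._∷_ b≡b′ v≡w

nat-injective : ∀ {k} (v w : Vec Bool k) → nat v ≡ nat w → v ≡ w
nat-injective v w eq = proj₂ (natFrom-injective 0 0 v w eq)

AgreeBelow : ℕ → Real → Real → Set
AgreeBelow m x y = ∀ i → i < m → x i ≡ y i

agree-or-firstDifference : ∀ m x y → AgreeBelow m x y ⊎ ∃[ k ] k < m × HIs x y k
agree-or-firstDifference zero    x y = inj₁ (λ _ ())
agree-or-firstDifference (suc m) x y with agree-or-firstDifference m x y
... | inj₂ (k , k<m , first) = inj₂ (k , m<n⇒m<1+n k<m , first)
... | inj₁ agree with x m ≟ᴮ y m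
...   | no  xm≢ym = inj₂ (m , n<1+n m , agree , xm≢ym)
...   | yes xm≡ym = inj₁ (λ i i<1+m → [ agree i , (λ { refl → xm≡ym }) ] (m<1+n⇒m<n∨m≡n i<1+m))

firstDifference-≤ : ∀ {x y x′ y′ k k′} → HIs x y k → AgreeBelow k′ x′ y′ →
  x k ≡ x′ k → y k ≡ y′ k → k′ ≤ k
firstDifference-≤ {k = k} (_ , xk≢yk) agree′ xk≡x′k yk≡y′k =
  ≮⇒≥ (λ k<k′ → xk≢yk (trans xk≡x′k (trans (agree′ k k<k′) (sym yk≡y′k))))

slice : Real → ℕ → (m : ℕ) → Vec Bool m
slice x l m = tabulate (λ i → x (l + toℕ i))

slice-≡⁺ : ∀ x y l m → (∀ t → t < m → x (l + t) ≡ y (l + t)) → slice x l m ≡ slice y l m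
slice-≡⁺ x y l m agree = tabulate-cong (λ i → agree (toℕ i) (toℕ<n i))

slice-≡⁻ : ∀ x y l m → slice x l m ≡ slice y l m → ∀ t → t < m → x (l + t) ≡ y (l + t)
slice-≡⁻ x y l m eq t t<m = subst (λ s → x (l + s) ≡ y (l + s)) (toℕ-fromℕ< t<m) (begin
  x (l + toℕ i)          ≡⟨ lookup∘tabulate _ i ⟨
  lookup (slice x l m) i ≡⟨ cong (λ v → lookup v i) eq ⟩
  lookup (slice y l m) i ≡⟨ lookup∘tabulate _ i ⟩
  y (l + toℕ i)          ∎)
  where
  open ≡-Reasoning
  i = fromℕ< t<m

restrict-≡⁺ : ∀ {d} → StrictlyIncreasing d → ∀ x y n →
  AgreeBelow (d (suc n)) x y → restrict d x n ≡ restrict d y n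
restrict-≡⁺ {d} d-inc x y n agree = slice-≡⁺ x y (d n) (len d n) (λ t t<len → agree _ (in-block t<len))
  where
  in-block : ∀ {t} → t < len d n → d n + t < d (suc n)
  in-block {t} t<len = subst (d n + t <_) (m+[n∸m]≡n (<⇒≤ (d-inc n))) (+-monoʳ-< (d n) t<len)

InBlock : (ℕ → ℕ) → ℕ → ℕ → Set
InBlock d n k = d n ≤ k × k < d (suc n)

restrict-≡⁻ : ∀ d x y n {i} → restrict d x n ≡ restrict d y n → InBlock d n i → x i ≡ y i
restrict-≡⁻ d x y n eq (dn≤i , i<dn+1) = subst (λ j → x j ≡ y j) (m+[n∸m]≡n dn≤i)
  (slice-≡⁻ x y (d n) (len d n) eq (_ ∸ d n) (∸-monoˡ-< i<dn+1 dn≤i))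

firstDifference-determined : ∀ {d n x y k x′ y′ k′} → HIs x y k → HIs x′ y′ k′ →
  InBlock d n k → InBlock d n k′ →
  restrict d x n ≡ restrict d x′ n → restrict d y n ≡ restrict d y′ n → k ≡ k′
firstDifference-determined {d} {n} {x} {y} {_} {x′} {y′} first first′ k-in k′-in x≡x′ y≡y′ = ≤-antisym
  (firstDifference-≤ first′ (proj₁ first) (sym (x-agree k′-in)) (sym (y-agree k′-in)))
  (firstDifference-≤ first (proj₁ first′) (x-agree k-in) (y-agree k-in))
  where
  x-agree : ∀ {i} → InBlock d n i → x i ≡ x′ i
  x-agree = restrict-≡⁻ d x x′ n x≡x′
  y-agree : ∀ {i} → InBlock d n i → y i ≡ y′ i
  y-agree = restrict-≡⁻ d y y′ n y≡y′

factor-through : ExcludedMiddle 0ℓ → {A B C : Set} (Q : A → Set) (g : A → B) (h : A → C) → C →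
  (∀ {a a′} → Q a → Q a′ → g a ≡ g a′ → h a ≡ h a′) →
  Σ (B → C) λ φ → ∀ {a} → Q a → φ (g a) ≡ h a
factor-through em {A} {B} {C} Q g h c₀ h-respects = (λ b → pick b em) , λ Qa → pick-spec Qa em
  where
  Fibre : B → Set
  Fibre b = Σ A λ a → Q a × g a ≡ b

  pick : ∀ b → Dec (Fibre b) → C
  pick b (yes (a , _)) = h a
  pick b (no _)        = c₀

  pick-spec : ∀ {a} → Q a → (fibre? : Dec (Fibre (g a))) → pick (g a) fibre? ≡ h a
  pick-spec Qa (yes (a′ , Qa′ , ga′≡ga)) = h-respects Qa′ Qa ga′≡ga
  pick-spec Qa (no ∉fibre)               = contradiction (_ , Qa , refl) ∉fibre

-- Walks each anti-diagonal from (a + b , 0) down to (0 , a + b).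
next : ℕ × ℕ → ℕ × ℕ
next (zero  , b) = suc b , 0
next (suc a , b) = a , suc b

unpair : ℕ → ℕ × ℕ
unpair zero    = 0 , 0
unpair (suc k) = next (unpair k)

unpair-along-diagonal : ∀ a b → ∃[ k ] unpair k ≡ (a + b , 0) → ∃[ k′ ] unpair k′ ≡ (a , b)
unpair-along-diagonal a zero    (k , eq) = k , trans eq (cong (_, 0) (+-identityʳ a))
unpair-along-diagonal a (suc b) (k , eq)
  with k′ , eq′ ← unpair-along-diagonal (suc a) b (k , trans eq (cong (_, 0) (+-suc a b))) =
  suc k′ , cong next eq′

unpair-axis : ∀ n → ∃[ k ] unpair k ≡ (n , 0)
unpair-axis zero = 0 , refl
unpair-axis (suc n) with k , eq ← unpair-along-diagonal 0 n (unpair-axis n) = suc k , cong next eq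

unpair-surjective : ∀ a b → ∃[ k ] unpair k ≡ (a , b)
unpair-surjective a b = unpair-along-diagonal a b (unpair-axis (a + b))

ThroughBinarySlaloms : SetOfReals → Set
ThroughBinarySlaloms X = ∀ d → PartitioningReal d → Σ (BinarySlalom d) λ B → SetGoesThroughBin d B X

ThroughSlaloms : SetOfReals → Set
ThroughSlaloms X = ∀ d → PartitioningReal d → Σ Slalom λ S → ImageGoesThrough d S X

binarySlaloms⇒slaloms : ∀ X → ThroughBinarySlaloms X → ThroughSlaloms X
binarySlaloms⇒slaloms X through d d-part with B , goes ← through d d-part = S , goes′
  where
  open BinarySlalom B using (bound) renaming (B to Bₙ)
  S : Slalom
  S = record { S = λ n → map nat (Bₙ n)
             ; bound = λ n → subst (_≤ n) (sym (length-map nat (Bₙ n))) (bound n) }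
  goes′ : ImageGoesThrough d S X
  goes′ x Xx with N , in-B ← goes x Xx = N , λ n N≤n → ∈-map⁺ nat (in-B n N≤n)

nat-leftInverse : ExcludedMiddle 0ℓ → ∀ m → Σ (ℕ → Vec Bool m) λ unnat → ∀ v → unnat (nat v) ≡ v
nat-leftInverse em m
  with unnat , spec ← factor-through em (λ _ → ⊤) nat (λ v → v) (replicate m false)
                                     (λ _ _ → nat-injective _ _) = unnat , λ _ → spec tt

slaloms⇒binarySlaloms : ExcludedMiddle 0ℓ → ∀ X → ThroughSlaloms X → ThroughBinarySlaloms X
slaloms⇒binarySlaloms em X through d d-part with S , goes ← through d d-part = B , goes′
  where
  open Slalom S using (bound) renaming (S to Sₙ)
  unnat : ∀ n → ℕ → Vec Bool (len d n)
  unnat n = proj₁ (nat-leftInverse em (len d n))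
  B : BinarySlalom d
  B = record { B = λ n → map (unnat n) (Sₙ n)
             ; bound = λ n → subst (_≤ n) (sym (length-map (unnat n) (Sₙ n))) (bound n) }
  goes′ : SetGoesThroughBin d B X
  goes′ x Xx with N , in-S ← goes x Xx = N , λ n N≤n →
    subst (_∈ _) (proj₂ (nat-leftInverse em (len d n)) (restrict d x n)) (∈-map⁺ (unnat n) (in-S n N≤n))

-- If entry k ≤ n < entry (k + 1), then a has at most k + 1 points below d (n + 1) ≤ d (entry (k + 1)),
-- so n / 2 ^ (k + 1) ≥ k + 1 pieces Y 0, …, Y k of the cover fit into block n.
entry : ℕ → ℕ
entry k = suc k * 2 ^ suc k

entry-inc : StrictlyIncreasing entry
entry-inc k = <-≤-trans (m<n+m (suc k * P) (m^n>0 2 (suc k))) (*-monoʳ-≤ (suc (suc k)) (m≤m+n P (P + 0)))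
  where P = 2 ^ suc k

module BinarySlalomFromSparseSet
  (em : ExcludedMiddle 0ℓ) {X : SetOfReals} {d : ℕ → ℕ} (d-inc : StrictlyIncreasing d)
  (a : ℕ → Bool) (Y : ℕ → SetOfReals) (cover : ∀ x → X x → ∃[ j ] Y j x)
  (H⊆a : ∀ j k → InH (Y j) k → a k ≡ true) (sparse : ∀ n → count a (d (entry n)) ≤ n) where

  trace : ℕ → Real → List Bool
  trace n x = map x (positions a (d (suc n)))

  c : ℕ → ℕ
  c n = count a (d (suc n))

  trace∈bitStrings : ∀ n x → trace n x ∈ bitStrings (c n)
  trace∈bitStrings n x = subst (λ l → trace n x ∈ bitStrings l)
    (trans (length-map x (positions a (d (suc n)))) (length-positions a (d (suc n)))) (∈-bitStrings (trace n x))

  -- Two reals of Y j first differing at k give k ∈ H(Y j) ⊆ a, which the positions record.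
  agree-by-positions : ∀ {j x x′} m → Y j x → Y j x′ →
    map x (positions a m) ≡ map x′ (positions a m) → AgreeBelow m x x′
  agree-by-positions {j} {x} {x′} m Yx Yx′ eq with agree-or-firstDifference m x x′
  ... | inj₁ agree             = agree
  ... | inj₂ (k , k<m , first) =
    contradiction (map-≡⇒≡-on eq (∈-positions a k<m (H⊆a j k (x , x′ , Yx , Yx′ , first)))) (proj₂ first)

  decoder : ∀ n j → Σ (List Bool → Vec Bool (len d n)) λ φ → ∀ {x} → Y j x → φ (trace n x) ≡ restrict d x n
  decoder n j = factor-through em (Y j) (trace n) (λ x → restrict d x n) (replicate _ false)
    (λ Yx Yx′ eq → restrict-≡⁺ d-inc _ _ n (agree-by-positions _ Yx Yx′ eq))

  decode : ∀ n j → List Bool → Vec Bool (len d n)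
  decode n j = proj₁ (decoder n j)

  instance
    2^c-nonZero : ∀ {n} → NonZero (2 ^ c n)
    2^c-nonZero {n} = m^n≢0 2 (c n)

  -- Block n admits the words of Y 0, …, Y (admitted n ∸ 1), at most 2 ^ c n of each.
  admitted : ℕ → ℕ
  admitted n = n / 2 ^ c n

  admitted-eventually : ∀ {j n} → entry j ≤ n → j < admitted n
  admitted-eventually {j} {n} ej≤n
    with k , ek≤n , n<ek+1 ← Increasing.bracket entry-inc n (≤-trans (Increasing.mono-≤ entry-inc {j = j} z≤n) ej≤n)
    = begin
    suc j                      ≡⟨ m*n/n≡m (suc j) (2 ^ c n) ⟨
    suc j * 2 ^ c n / 2 ^ c n  ≤⟨ /-monoˡ-≤ (2 ^ c n) (≤-trans (*-mono-≤ (s≤s j≤k) (^-monoʳ-≤ 2 cn≤1+k)) ek≤n) ⟩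
    n / 2 ^ c n                ∎
    where
    open ≤-Reasoning
    j≤k : j ≤ k
    j≤k = s≤s⁻¹ (Increasing.cancel-< entry-inc (≤-<-trans ej≤n n<ek+1))
    cn≤1+k : c n ≤ suc k
    cn≤1+k = ≤-trans (count-mono a (Increasing.mono-≤ d-inc n<ek+1)) (sparse (suc k))

  slalom : BinarySlalom d
  slalom = record
    { B     = λ n → cartesianProductWith (decode n) (upTo (admitted n)) (bitStrings (c n))
    ; bound = λ n → begin
      length (cartesianProductWith (decode n) (upTo (admitted n)) (bitStrings (c n)))
        ≡⟨ length-cartesianProductWith (decode n) (upTo (admitted n)) (bitStrings (c n)) ⟩
      length (upTo (admitted n)) * length (bitStrings (c n))
        ≡⟨ cong₂ _*_ (length-upTo (admitted n)) (length-bitStrings (c n)) ⟩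
      admitted n * 2 ^ c n
        ≤⟨ m/n*n≤m n (2 ^ c n) ⟩
      n ∎ }
    where open ≤-Reasoning

  goes-through : SetGoesThroughBin d slalom X
  goes-through x Xx with j , Yjx ← cover x Xx = entry j , λ n ej≤n →
    subst (_∈ _) (proj₂ (decoder n j) Yjx)
      (∈-cartesianProductWith⁺ (decode n) (∈-upTo⁺ (admitted-eventually ej≤n)) (trace∈bitStrings n x))

rapid⇒binarySlaloms : ExcludedMiddle 0ℓ → ∀ X → Rapid (RaisonnierFilter X) → ThroughBinarySlaloms X
rapid⇒binarySlaloms em X rapid d (_ , d-inc)
  with a , (Y , cover , H⊆a) , sparse ← rapid (λ k → d (entry k)) (λ k → Increasing.mono-< d-inc (entry-inc k)) =
  slalom , goes-through
  where open BinarySlalomFromSparseSet em d-inc a Y cover H⊆a sparse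

squareSum : ℕ → ℕ
squareSum zero    = 0
squareSum (suc n) = suc n * suc n + squareSum n

-- a has at most 0² + ⋯ + n² points below d (n + 1); starting block n at f (0² + ⋯ + n²)
-- turns this into at most m points below f m.
blocks : (ℕ → ℕ) → ℕ → ℕ
blocks f zero    = 0
blocks f (suc n) = f (squareSum (suc n))

blocks-inc : ∀ {f} → StrictlyIncreasing f → StrictlyIncreasing (blocks f)
blocks-inc f-inc zero    = ≤-<-trans z≤n (f-inc 0)
blocks-inc f-inc (suc n) = Increasing.mono-< f-inc (m<n+m (squareSum (suc n)) {suc (suc n) * suc (suc n)} (s≤s z≤n))

module SparseSetFromBinarySlalom
  (em : ExcludedMiddle 0ℓ) {X : SetOfReals} {f : ℕ → ℕ} (f-inc : StrictlyIncreasing f)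
  (S : BinarySlalom (blocks f)) (goes : SetGoesThroughBin (blocks f) S X) where

  open BinarySlalom S

  d : ℕ → ℕ
  d = blocks f

  d-inc : StrictlyIncreasing d
  d-inc = blocks-inc f-inc

  -- Cell (N , s): going through S from block N on, with initial segment below d N of code s.
  Cell : ℕ × ℕ → SetOfReals
  Cell p x = (∀ n → proj₁ p ≤ n → restrict d x n ∈ B n) × nat (slice x 0 (d (proj₁ p))) ≡ proj₂ p

  Y : ℕ → SetOfReals
  Y k = Cell (unpair k)

  cover : ∀ x → X x → ∃[ k ] Y k x
  cover x Xx with N , in-B ← goes x Xx with k , unpair-k ← unpair-surjective N (nat (slice x 0 (d N))) =
    k , subst (λ p → Cell p x) (sym unpair-k) (in-B , refl)

  a : ℕ → Bool
  a k = isYes (em {∃[ j ] InH (Y j) k})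

  H⊆a : ∀ j k → InH (Y j) k → a k ≡ true
  H⊆a j k k∈H = Equivalence.to T-≡ (fromWitness (j , k∈H))

  firstDifferenceOf : ∀ n → Σ (Vec Bool (len d n) × Vec Bool (len d n) → ℕ) λ φ →
    ∀ {x y k} → HIs x y k × InBlock d n k → φ (restrict d x n , restrict d y n) ≡ k
  firstDifferenceOf n
    with φ , spec ← factor-through em (λ (x , y , k) → HIs x y k × InBlock d n k)
                                      (λ (x , y , _) → restrict d x n , restrict d y n) (λ (_ , _ , k) → k) 0
                                      (λ (first , k-in) (first′ , k′-in) eq →
                                        firstDifference-determined {d} {n} first first′ k-in k′-in
                                                                   (cong proj₁ eq) (cong proj₂ eq))
    = φ , λ {x} {y} {k} → spec {x , y , k}

  candidates : ℕ → List ℕ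
  candidates n = cartesianProductWith (curry (proj₁ (firstDifferenceOf n))) (B n) (B n)

  length-candidates : ∀ n → length (candidates n) ≤ n * n
  length-candidates n = ≤-trans (≤-reflexive (length-cartesianProductWith _ (B n) (B n)))
                                (*-mono-≤ (bound n) (bound n))

  ∈-candidates : ∀ n {k} → d n ≤ k → k < d (suc n) → a k ≡ true → k ∈ candidates n
  ∈-candidates n {k} dn≤k k<dn+1 ak
    with j , x , y , (x-in-B , x-code) , (y-in-B , y-code) , first ← toWitness (Equivalence.from T-≡ ak) =
    subst (_∈ candidates n) (proj₂ (firstDifferenceOf n) (first , dn≤k , k<dn+1))
      (∈-cartesianProductWith⁺ _ (x-in-B n N≤n) (y-in-B n N≤n))
    where
    N = proj₁ (unpair j)
    agree : AgreeBelow (d N) x y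
    agree = slice-≡⁻ x y 0 (d N) (nat-injective _ _ (trans x-code (sym y-code)))
    N≤n : N ≤ n
    N≤n = s≤s⁻¹ (Increasing.cancel-< d-inc (≤-<-trans (firstDifference-≤ first agree refl refl) k<dn+1))

  count-block : ∀ n → count a (d (suc n)) ≤ count a (d n) + n * n
  count-block n = ≤-trans (count-≤-+length a (candidates n) (<⇒≤ (d-inc n)) (∈-candidates n))
                          (+-monoʳ-≤ (count a (d n)) (length-candidates n))

  count-below : ∀ n → count a (d (suc n)) ≤ squareSum n
  count-below zero    = count-block 0
  count-below (suc n) = begin
    count a (d (suc (suc n)))          ≤⟨ count-block (suc n) ⟩
    count a (d (suc n)) + suc n * suc n ≤⟨ +-monoˡ-≤ (suc n * suc n) (count-below n) ⟩
    squareSum n + suc n * suc n         ≡⟨ +-comm (squareSum n) (suc n * suc n) ⟩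
    squareSum (suc n)                   ∎
    where open ≤-Reasoning

  sparse : ∀ m → count a (f m) ≤ m
  sparse m with n , dn≤fm , fm<dn+1 ← Increasing.bracket d-inc (f m) z≤n =
    ≤-trans (count-mono a (<⇒≤ fm<dn+1)) (≤-trans (count-below n) (squareSum≤ n dn≤fm))
    where
    squareSum≤ : ∀ n → d n ≤ f m → squareSum n ≤ m
    squareSum≤ zero    _     = z≤n
    squareSum≤ (suc n) dn≤fm = Increasing.cancel-≤ f-inc dn≤fm

binarySlaloms⇒rapid : ExcludedMiddle 0ℓ → ∀ X → ThroughBinarySlaloms X → Rapid (RaisonnierFilter X)
binarySlaloms⇒rapid em X through f f-inc with S , goes ← through (blocks f) (refl , blocks-inc f-inc) =
  a , (Y , cover , H⊆a) , sparse
  where open SparseSetFromBinarySlalom em f-inc S goes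

theorem4p9 : (em : ∀ {ℓ : Level} → ExcludedMiddle ℓ) → (X : SetOfReals) →
    (Rapid (RaisonnierFilter X)
      ⇔ (∀ (d : ℕ → ℕ) → PartitioningReal d → Σ (BinarySlalom d) λ B → SetGoesThroughBin d B X))
    × ((∀ (d : ℕ → ℕ) → PartitioningReal d → Σ (BinarySlalom d) λ B → SetGoesThroughBin d B X)
      ⇔ (∀ (d : ℕ → ℕ) → PartitioningReal d → Σ Slalom λ S → ImageGoesThrough d S X))
theorem4p9 em X = mk⇔ (rapid⇒binarySlaloms em X) (binarySlaloms⇒rapid em X)
                , mk⇔ (binarySlaloms⇒slaloms X) (slaloms⇒binarySlaloms em X)
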